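{- Let $\mathcal{G}$ be the family of $H$-minor-free graphs for some fixed graph $H$, and let $d$ be the maximal density of a graph in $\mathcal{G}$ (so $|E(G)|\le d|V(G)|$ for all $G\in\mathcal{G}$). Then for each $n$-vertex connected graph $G\in\mathcal{G}$ there exists a cloud partition $\mathcal{P}$ of $G$ that contains $O(n/\log n)$ $\phi$-critical clouds, where $\phi=d+1$.
   Context: Fix a constant $c>0$; $\log$ is base 2. A cloud partition of a connected graph $G=(V,E)$ is a partition of $V$ obtained as follows: initially all vertices are unvisited; while an unvisited vertex exists, choose an arbitrary unvisited vertex $v$ and run a breadth-first search from $v$ that only traverses unvisited vertices, marking each traversed vertex visited, and stopping as soon as $\lceil c\log n\rceil$ vertices have been visited in this search or no further unvisited vertex is reachable; the vertices visited form one part, called a cloud. Two clouds are adjacent if some edge of $G$ joins a vertex of one to a vertex of the other. A cloud is big if it has exactly $\lceil c\log n\rceil$ vertices and small otherwise. For an integer $\phi$, a $\phi$-critical cloud is a small cloud adjacent to at least $\phi$ big clouds.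
   Formalization: The constant $c>0$ in the cloud size ranges over the positive rationals. -}

module Defs where

open import Data.Nat using (ℕ; zero; suc; _+_; _*_; _^_; _≤_; _<_; _≤ᵇ_; _<ᵇ_; _≡ᵇ_)
open import Data.Bool using (Bool; true; false; _∧_; not; if_then_else_)
open import Data.Fin using (Fin; toℕ)
open import Data.List using (List; []; _∷_; _++_; [_]; length; concat; allFin; cartesianProduct)
open import Data.Bool.ListAction using (any)
open import Data.List.Membership.Propositional using (_∈_; _∉_)
open import Data.Product using (Σ; ∃; ∃-syntax; _×_; _,_)
open import Data.Sum using (_⊎_)
open import Data.Unit using (⊤)
open import Relation.Nullary using (¬_)
open import Relation.Binary.PropositionalEquality using (_≡_)
open import Relation.Binary.Construct.Closure.ReflexiveTransitive using (Star)

record Graph (n : ℕ) : Set where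
  field
    adj    : Fin n → Fin n → Bool
    sym    : ∀ i j → adj i j ≡ adj j i
    irrefl : ∀ i → adj i i ≡ false
open Graph public

countB : {A : Set} → (A → Bool) → List A → ℕ
countB p [] = 0
countB p (x ∷ xs) = if p x then suc (countB p xs) else countB p xs

edgeCount : {n : ℕ} → Graph n → ℕ
edgeCount {n} G =
  countB (λ { (i , j) → (toℕ i <ᵇ toℕ j) ∧ adj G i j })
         (cartesianProduct (allFin n) (allFin n))

data Walk {n : ℕ} (G : Graph n) (S : Fin n → Set) : Fin n → Fin n → Set where
  here  : ∀ {x} → S x → Walk G S x x
  there : ∀ {x y z} → S x → adj G x y ≡ true → Walk G S y z → Walk G S x z

Connected : {n : ℕ} → Graph n → Set
Connected G = ∀ x y → Walk G (λ _ → ⊤) x y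

record MinorModel {h n : ℕ} (H : Graph h) (G : Graph n) : Set where
  field
    branch    : Fin h → List (Fin n)
    nonempty  : ∀ i → ∃[ x ] (x ∈ branch i)
    disjoint  : ∀ i j x → x ∈ branch i → x ∈ branch j → i ≡ j
    connected : ∀ i x y → x ∈ branch i → y ∈ branch i → Walk G (λ z → z ∈ branch i) x y
    edges     : ∀ i j → adj H i j ≡ true →
                ∃[ x ] ∃[ y ] (x ∈ branch i × y ∈ branch j × adj G x y ≡ true)

MinorFree : {h n : ℕ} → Graph h → Graph n → Set
MinorFree H G = ¬ MinorModel H G

-- s = ⌈ (p/q) · log₂ n ⌉ , i.e. s is least with n^p ≤ 2^(s·q)
IsCeilCLog : ℕ → ℕ → ℕ → ℕ → Set
IsCeilCLog p q n s = (n ^ p ≤ 2 ^ (s * q)) × (∀ t → n ^ p ≤ 2 ^ (t * q) → s ≤ t)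

-- One step of a breadth-first search in G that avoids the already visited
-- vertices W and may visit at most s vertices.  State = (visited list, queue).
BFSState : ℕ → Set
BFSState n = List (Fin n) × List (Fin n)

data BFSStep {n : ℕ} (G : Graph n) (W : List (Fin n)) (s : ℕ) :
             BFSState n → BFSState n → Set where
  discover : ∀ {vis u q w} → adj G u w ≡ true → w ∉ W → w ∉ vis → length vis < s →
             BFSStep G W s (vis , u ∷ q) (vis ++ [ w ] , (u ∷ q) ++ [ w ])
  dequeue  : ∀ {vis u q} → (∀ w → adj G u w ≡ true → w ∉ W → w ∈ vis) →
             BFSStep G W s (vis , u ∷ q) (vis , q)

BFSRun : {n : ℕ} → Graph n → List (Fin n) → ℕ → Fin n → List (Fin n) → Set
BFSRun G W s v C =
  ∃[ q ] (Star (BFSStep G W s) ([ v ] , [ v ]) (C , q) × (length C ≡ s ⊎ q ≡ []))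

data CloudProcess {n : ℕ} (G : Graph n) (s : ℕ) : List (List (Fin n)) → Set where
  start : CloudProcess G s []
  step  : ∀ {P v C} → CloudProcess G s P → v ∉ concat P →
          BFSRun G (concat P) s v C → CloudProcess G s (P ++ [ C ])

CloudPartition : {n : ℕ} → Graph n → ℕ → List (List (Fin n)) → Set
CloudPartition G s P = CloudProcess G s P × (∀ x → x ∈ concat P)

isBig : {n : ℕ} → ℕ → List (Fin n) → Bool
isBig s C = length C ≡ᵇ s

cloudsAdj : {n : ℕ} → Graph n → List (Fin n) → List (Fin n) → Bool
cloudsAdj G C D = any (λ x → any (λ y → adj G x y) D) C

bigNeighbours : {n : ℕ} → Graph n → ℕ → List (List (Fin n)) → List (Fin n) → ℕ
bigNeighbours G s P C = countB (λ D → isBig s D ∧ cloudsAdj G C D) P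

criticalCount : {n : ℕ} → Graph n → ℕ → ℕ → List (List (Fin n)) → ℕ
criticalCount G s φ P = countB (λ C → not (isBig s C) ∧ (φ ≤ᵇ bigNeighbours G s P C)) P

-- The cloud process always runs to completion, and its clouds are disjoint, nonempty and
-- connected. Contracting the k critical and the B big clouds therefore gives a minor of G: an
-- H-minor-free graph on k + B vertices, so with at most d(k + B) edges. Every critical cloud
-- is adjacent to at least d + 1 big ones, which yields at least k(d + 1) edges, hence k ≤ dB.
-- The big clouds are disjoint sets of s vertices, so Bs ≤ n, while ⌊log₂ n⌋ ≤ sq because
-- n ≤ n^p ≤ 2^(sq). Altogether k ⌊log₂ n⌋ ≤ dB · sq ≤ dq · n.

module Submission where

open import Defs hiding (sym)
open import Data.Nat using (ℕ; zero; suc; _+_; _*_; _∸_; _^_; _≤_; _<_; _≤ᵇ_; _<ᵇ_; z≤n; s≤s; z<s; s<s; >-nonZero)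
open import Data.Nat.Properties hiding (_≟_)
open import Data.Nat.ListAction using (sum)
open import Data.Nat.Logarithm using (⌊log₂_⌋; ⌊log₂⌋-mono-≤; ⌊log₂[2^n]⌋≡n)
open import Data.Nat.Solver using (module +-*-Solver)
open import Data.Bool using (Bool; true; false; _∧_; not; if_then_else_; T; T?)
open import Data.Bool.Properties using (T-≡; T-∧; ∧-conicalˡ; ∧-conicalʳ) renaming (_≟_ to _≟ᵇ_)
open import Data.Fin using (Fin; toℕ; zero; suc; _≟_)
open import Data.Fin.Properties using (any?; pigeonhole)
open import Data.List using (List; []; _∷_; _++_; [_]; length; concat; map; tabulate; lookup; allFin; cartesianProduct; filterᵇ)
open import Data.List.Properties using (length-++; concat-++; ++-identityʳ; map-tabulate; tabulate-lookup)
open import Data.List.Membership.Propositional using (_∈_; _∉_; find; lose)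
open import Data.List.Membership.Propositional.Properties
  using (∈-++⁺ˡ; ∈-++⁺ʳ; ∈-++⁻; ∈-concat⁺′; ∈-concat⁻′; ∈-map⁺; ∈-map⁻; ∈-filter⁻; ∈-lookup; ∈-length)
import Data.List.Membership.DecPropositional as DecMembership
open import Data.List.Relation.Unary.Any using (here; there)
open import Data.List.Relation.Unary.Any.Properties using (any⁺; any⁻)
open import Data.List.Relation.Unary.All as All using (All; []; _∷_)
import Data.List.Relation.Unary.All.Properties as All
open import Data.List.Relation.Unary.AllPairs as AllPairs using (AllPairs; []; _∷_)
import Data.List.Relation.Unary.AllPairs.Properties as AllPairs
open import Data.List.Relation.Unary.Unique.Propositional using (Unique)
import Data.List.Relation.Unary.Unique.Propositional.Properties as Unique
open import Data.List.Relation.Binary.Disjoint.Propositional using (Disjoint)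
import Data.List.Relation.Binary.Disjoint.Propositional.Properties as Disjoint
open import Data.Product using (∃; ∃-syntax; _×_; _,_; proj₁; proj₂)
open import Data.Sum using (_⊎_; inj₁; inj₂)
open import Function.Base using (_∘_)
open import Function.Bundles using (Equivalence)
open import Relation.Nullary using (¬_; yes; no; does; ¬?; _×-dec_; contradiction)
open import Relation.Nullary.Decidable using (decidable-stable)
open import Relation.Binary.PropositionalEquality
  using (_≡_; _≢_; refl; sym; trans; cong; cong₂; subst; module ≡-Reasoning)
open import Relation.Binary.Construct.Closure.ReflexiveTransitive using (Star; ε; _◅_)

private
  variable
    A : Set
    n m h : ℕ

≡true⇔≡true⇒≡ : {a b : Bool} → (a ≡ true → b ≡ true) → (b ≡ true → a ≡ true) → a ≡ b
≡true⇔≡true⇒≡ {false} {false} _   _   = refl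
≡true⇔≡true⇒≡ {false} {true}  _   b⇒a = b⇒a refl
≡true⇔≡true⇒≡ {true}          a⇒b _   = sym (a⇒b refl)

<⇒<ᵇ≡true : ∀ {a b} → a < b → (a <ᵇ b) ≡ true
<⇒<ᵇ≡true a<b = Equivalence.to T-≡ (<⇒<ᵇ a<b)

not-<ᵇ≡true⇒≥ : ∀ {a b} → not (a <ᵇ b) ≡ true → b ≤ a
not-<ᵇ≡true⇒≥ {a} {b} e = ≮⇒≥ λ a<b → false≢true (subst (λ x → not x ≡ true) (<⇒<ᵇ≡true a<b) e)
  where
  false≢true : false ≢ true
  false≢true ()

-- Counting

countB-++ : (p : A → Bool) (xs ys : List A) → countB p (xs ++ ys) ≡ countB p xs + countB p ys
countB-++ p [] ys = refl
countB-++ p (x ∷ xs) ys with p x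
... | true  = cong suc (countB-++ p xs ys)
... | false = countB-++ p xs ys

countB-map : (p : A → Bool) {B : Set} (f : B → A) (xs : List B) → countB p (map f xs) ≡ countB (λ x → p (f x)) xs
countB-map p f [] = refl
countB-map p f (x ∷ xs) with p (f x)
... | true  = cong suc (countB-map p f xs)
... | false = countB-map p f xs

countB-mono : {p q : A → Bool} → (∀ x → p x ≡ true → q x ≡ true) → ∀ xs → countB p xs ≤ countB q xs
countB-mono p⇒q [] = z≤n
countB-mono {p = p} {q} p⇒q (x ∷ xs) with p x in px | q x in qx
... | true  | true  = s≤s (countB-mono p⇒q xs)
... | true  | false = contradiction (trans (sym (p⇒q x px)) qx) λ ()
... | false | true  = m≤n⇒m≤1+n (countB-mono p⇒q xs)
... | false | false = countB-mono p⇒q xs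

countB-cong : {p q : A → Bool} → (∀ x → p x ≡ q x) → ∀ xs → countB p xs ≡ countB q xs
countB-cong p≗q [] = refl
countB-cong {p = p} {q} p≗q (x ∷ xs) rewrite p≗q x = cong (λ c → if q x then suc c else c) (countB-cong p≗q xs)

countB≡length-filterᵇ : (p : A → Bool) (xs : List A) → countB p xs ≡ length (filterᵇ p xs)
countB≡length-filterᵇ p [] = refl
countB≡length-filterᵇ p (x ∷ xs) with p x
... | true  = cong suc (countB≡length-filterᵇ p xs)
... | false = countB≡length-filterᵇ p xs

countB-∧ : (p q : A → Bool) (xs : List A) → countB (λ x → p x ∧ q x) xs ≡ countB q (filterᵇ p xs)
countB-∧ p q [] = refl
countB-∧ p q (x ∷ xs) with p x
... | false = countB-∧ p q xs
... | true with q x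
...   | true  = cong suc (countB-∧ p q xs)
...   | false = countB-∧ p q xs

countB-cartesianProduct : {B : Set} (p : A × B → Bool) (xs : List A) (ys : List B) →
  countB p (cartesianProduct xs ys) ≡ sum (map (λ x → countB (λ y → p (x , y)) ys) xs)
countB-cartesianProduct p [] ys = refl
countB-cartesianProduct p (x ∷ xs) ys = begin
  countB p (map (x ,_) ys ++ cartesianProduct xs ys)
    ≡⟨ countB-++ p (map (x ,_) ys) (cartesianProduct xs ys) ⟩
  countB p (map (x ,_) ys) + countB p (cartesianProduct xs ys)
    ≡⟨ cong₂ _+_ (countB-map p (x ,_) ys) (countB-cartesianProduct p xs ys) ⟩
  countB (λ y → p (x , y)) ys + sum (map (λ x → countB (λ y → p (x , y)) ys) xs) ∎
  where open ≡-Reasoning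

countB-lookup : (p : A → Bool) (xs : List A) → countB (λ i → p (lookup xs i)) (allFin (length xs)) ≡ countB p xs
countB-lookup p xs = begin
  countB (λ i → p (lookup xs i)) (allFin (length xs)) ≡⟨ countB-map p (lookup xs) (allFin _) ⟨
  countB p (map (lookup xs) (allFin (length xs)))     ≡⟨ cong (countB p) (map-tabulate (λ i → i) (lookup xs)) ⟩
  countB p (tabulate (lookup xs))                     ≡⟨ cong (countB p) (tabulate-lookup xs) ⟩
  countB p xs ∎
  where open ≡-Reasoning

countB-tabulate-suc : (p : Fin (suc n) → Bool) → countB p (tabulate suc) ≡ countB (λ i → p (suc i)) (allFin n)
countB-tabulate-suc {n} p = trans (cong (countB p) (sym (map-tabulate (λ i → i) suc))) (countB-map p suc (allFin n))

countB-suffix : (xs ys : List A) (p : A → Bool) →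
  countB (λ j → not (toℕ j <ᵇ length xs) ∧ p (lookup (xs ++ ys) j)) (allFin (length (xs ++ ys))) ≡ countB p ys
countB-suffix [] ys p = countB-lookup p ys
countB-suffix (x ∷ xs) ys p =
  trans (countB-tabulate-suc {n = length (xs ++ ys)} _) (countB-suffix xs ys p)

sum-tabulate-≥ : ∀ {k c} (f : Fin n → ℕ) → k ≤ n → (∀ i → toℕ i < k → c ≤ f i) → k * c ≤ sum (tabulate f)
sum-tabulate-≥ {k = zero} f _ _ = z≤n
sum-tabulate-≥ {suc n} {suc k} f (s≤s k≤n) f≥c =
  +-mono-≤ (f≥c zero z<s) (sum-tabulate-≥ (λ i → f (suc i)) k≤n (λ i i<k → f≥c (suc i) (s<s i<k)))

forwardDegree : Graph n → Fin n → ℕ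
forwardDegree {n} G i = countB (λ j → (toℕ i <ᵇ toℕ j) ∧ adj G i j) (allFin n)

edgeCount≡sum-forwardDegree : (G : Graph n) → edgeCount G ≡ sum (tabulate (forwardDegree G))
edgeCount≡sum-forwardDegree {n} G =
  trans (countB-cartesianProduct _ (allFin n) (allFin n)) (cong sum (map-tabulate (λ i → i) (forwardDegree G)))

-- An edge from one of the first k vertices to a vertex beyond k is a forward edge of the former.
k*c≤edgeCount : (G : Graph n) {k c : ℕ} → k ≤ n →
  (∀ i → toℕ i < k → c ≤ countB (λ j → not (toℕ j <ᵇ k) ∧ adj G i j) (allFin n)) →
  k * c ≤ edgeCount G
k*c≤edgeCount {n} G {k} k≤n deg≥c = subst (_ ≤_) (sym (edgeCount≡sum-forwardDegree G))
  (sum-tabulate-≥ _ k≤n λ i i<k → ≤-trans (deg≥c i i<k) (countB-mono (forward i<k) (allFin n)))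
  where
  forward : ∀ {i} → toℕ i < k → ∀ j → not (toℕ j <ᵇ k) ∧ adj G i j ≡ true → (toℕ i <ᵇ toℕ j) ∧ adj G i j ≡ true
  forward i<k j e rewrite <⇒<ᵇ≡true (<-≤-trans i<k (not-<ᵇ≡true⇒≥ (∧-conicalˡ _ _ e))) = ∧-conicalʳ _ _ e

-- Walks and minors

module _ {G : Graph n} where

  walk-source : ∀ {S x y} → Walk G S x y → S x
  walk-source (here sx)      = sx
  walk-source (there sx _ _) = sx

  walk-weaken : ∀ {S T : Fin n → Set} → (∀ {z} → S z → T z) → ∀ {x y} → Walk G S x y → Walk G T x y
  walk-weaken S⇒T (here sx)      = here (S⇒T sx)
  walk-weaken S⇒T (there sx e w) = there (S⇒T sx) e (walk-weaken S⇒T w)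

  walk-++ : ∀ {S x y z} → Walk G S x y → Walk G S y z → Walk G S x z
  walk-++ (here _)       w′ = w′
  walk-++ (there sx e w) w′ = there sx e (walk-++ w w′)

  walk-reverse : ∀ {S x y} → Walk G S x y → Walk G S y x
  walk-reverse (here sx)      = here sx
  walk-reverse (there sx e w) =
    walk-++ (walk-reverse w) (there (walk-source w) (trans (Graph.sym G _ _) e) (here sx))

ConnectedOn : (G : Graph n) → List (Fin n) → Set
ConnectedOn G C = ∀ x y → x ∈ C → y ∈ C → Walk G (_∈ C) x y

module _ {H : Graph h} {G′ : Graph m} {G : Graph n} (M : MinorModel H G′) (N : MinorModel G′ G) where
  private
    module M = MinorModel M
    module N = MinorModel N

  composedBranch : Fin h → List (Fin n)
  composedBranch a = concat (map N.branch (M.branch a))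

  ∈-composedBranch⁺ : ∀ {a i x} → i ∈ M.branch a → x ∈ N.branch i → x ∈ composedBranch a
  ∈-composedBranch⁺ i∈ x∈ = ∈-concat⁺′ x∈ (∈-map⁺ N.branch i∈)

  ∈-composedBranch⁻ : ∀ {a x} → x ∈ composedBranch a → ∃[ i ] (i ∈ M.branch a × x ∈ N.branch i)
  ∈-composedBranch⁻ {a} x∈ with ∈-concat⁻′ (map N.branch (M.branch a)) x∈
  ... | _ , x∈ys , ys∈ with ∈-map⁻ N.branch ys∈
  ...   | i , i∈ , refl = i , i∈ , x∈ys

  walk-expand : ∀ {a i j x y} → Walk G′ (_∈ M.branch a) i j → x ∈ N.branch i → y ∈ N.branch j →
    Walk G (_∈ composedBranch a) x y
  walk-expand (here i∈) x∈ y∈ = walk-weaken (∈-composedBranch⁺ i∈) (N.connected _ _ _ x∈ y∈)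
  walk-expand (there i∈ e w) x∈ y∈ with N.edges _ _ e
  ... | x′ , y′ , x′∈ , y′∈ , e′ =
    walk-++ (walk-weaken (∈-composedBranch⁺ i∈) (N.connected _ _ _ x∈ x′∈))
            (there (∈-composedBranch⁺ i∈ x′∈) e′ (walk-expand w y′∈ y∈))

  minorModel-∘ : MinorModel H G
  minorModel-∘ = record
    { branch    = composedBranch
    ; nonempty  = λ a → let i , i∈ = M.nonempty a ; x , x∈ = N.nonempty i in x , ∈-composedBranch⁺ i∈ x∈
    ; disjoint  = λ a b x x∈a x∈b →
        let i , i∈ , x∈i = ∈-composedBranch⁻ x∈a ; j , j∈ , x∈j = ∈-composedBranch⁻ x∈b
        in M.disjoint a b i i∈ (subst (_∈ M.branch b) (sym (N.disjoint i j x x∈i x∈j)) j∈)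
    ; connected = λ a x y x∈ y∈ →
        let i , i∈ , x∈i = ∈-composedBranch⁻ x∈ ; j , j∈ , y∈j = ∈-composedBranch⁻ y∈
        in walk-expand (M.connected a i j i∈ j∈) x∈i y∈j
    ; edges     = λ a b e →
        let i , j , i∈ , j∈ , e′ = M.edges a b e ; x , y , x∈ , y∈ , e″ = N.edges i j e′
        in x , y , ∈-composedBranch⁺ i∈ x∈ , ∈-composedBranch⁺ j∈ y∈ , e″ }

minorFree-minor : {H : Graph h} {G′ : Graph m} {G : Graph n} → MinorModel G′ G → MinorFree H G → MinorFree H G′
minorFree-minor N H-free M = H-free (minorModel-∘ M N)

-- Clouds

module _ (G : Graph n) where

  cloudsAdj-sound : ∀ {C D} → cloudsAdj G C D ≡ true → ∃[ x ] ∃[ y ] (x ∈ C × y ∈ D × adj G x y ≡ true)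
  cloudsAdj-sound {C} {D} e with find (any⁻ _ C (Equivalence.from T-≡ e))
  ... | x , x∈ , Tx with find (any⁻ _ D Tx)
  ...   | y , y∈ , Txy = x , y , x∈ , y∈ , Equivalence.to T-≡ Txy

  cloudsAdj-complete : ∀ {C D x y} → x ∈ C → y ∈ D → adj G x y ≡ true → cloudsAdj G C D ≡ true
  cloudsAdj-complete x∈ y∈ e =
    Equivalence.to T-≡ (any⁺ _ (lose x∈ (any⁺ _ (lose y∈ (Equivalence.from T-≡ e)))))

  cloudsAdj-sym : ∀ C D → cloudsAdj G C D ≡ cloudsAdj G D C
  cloudsAdj-sym C D = ≡true⇔≡true⇒≡ (swap C D) (swap D C)
    where
    swap : ∀ C D → cloudsAdj G C D ≡ true → cloudsAdj G D C ≡ true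
    swap C D e =
      let x , y , x∈ , y∈ , x~y = cloudsAdj-sound {C} {D} e
      in cloudsAdj-complete {D} {C} y∈ x∈ (trans (Graph.sym G y x) x~y)

does-≟-refl : (i : Fin n) → does (i ≟ i) ≡ true
does-≟-refl i with i ≟ i
... | yes _  = refl
... | no i≢i = contradiction refl i≢i

does-≟-sym : (i j : Fin n) → does (i ≟ j) ≡ does (j ≟ i)
does-≟-sym i j with i ≟ j | j ≟ i
... | yes _   | yes _   = refl
... | no  _   | no  _   = refl
... | yes i≡j | no  j≢i = contradiction (sym i≡j) j≢i
... | no  i≢j | yes j≡i = contradiction (sym j≡i) i≢j

contraction : (G : Graph n) (L : List (List (Fin n))) → Graph (length L)
contraction G L = record
  { adj    = λ i j → not (does (i ≟ j)) ∧ cloudsAdj G (lookup L i) (lookup L j)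
  ; sym    = λ i j → cong₂ (λ a b → not a ∧ b) (does-≟-sym i j) (cloudsAdj-sym G (lookup L i) (lookup L j))
  ; irrefl = λ i → cong (λ a → not a ∧ cloudsAdj G (lookup L i) (lookup L i)) (does-≟-refl i) }

record IsCloud (G : Graph n) (C : List (Fin n)) : Set where
  field
    unique    : Unique C
    nonempty  : ∃[ x ] x ∈ C
    connected : ConnectedOn G C

record IsCloudFamily (G : Graph n) (P : List (List (Fin n))) : Set where
  field
    clouds   : All (IsCloud G) P
    disjoint : AllPairs Disjoint P

lookup-disjoint : {L : List (List A)} → AllPairs Disjoint L →
  ∀ i j {x} → x ∈ lookup L i → x ∈ lookup L j → i ≡ j
lookup-disjoint {L = _ ∷ _} _ zero zero _ _ = refl
lookup-disjoint {L = _ ∷ _} (C# ∷ _) zero (suc j) x∈C x∈D = contradiction (x∈C , x∈D) (All.lookup C# (∈-lookup j))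
lookup-disjoint {L = _ ∷ _} (C# ∷ _) (suc i) zero x∈D x∈C = contradiction (x∈C , x∈D) (All.lookup C# (∈-lookup i))
lookup-disjoint {L = _ ∷ _} (_ ∷ L#) (suc i) (suc j) x∈C x∈D = cong suc (lookup-disjoint L# i j x∈C x∈D)

contraction-minor : {G : Graph n} {L : List (List (Fin n))} → IsCloudFamily G L → MinorModel (contraction G L) G
contraction-minor {G = G} {L} F = record
  { branch    = lookup L
  ; nonempty  = λ i → IsCloud.nonempty (cloud i)
  ; disjoint  = λ i j _ → lookup-disjoint (IsCloudFamily.disjoint F) i j
  ; connected = λ i → IsCloud.connected (cloud i)
  ; edges     = λ i j e → cloudsAdj-sound G (∧-conicalʳ _ _ e) }
  where
  cloud : ∀ i → IsCloud G (lookup L i)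
  cloud i = All.lookup (IsCloudFamily.clouds F) (∈-lookup i)

-- Breadth-first search

record BFSInvariant (G : Graph n) (W : List (Fin n)) (v : Fin n) (st : BFSState n) : Set where
  field
    unique  : Unique (proj₁ st)
    fresh   : All (_∉ W) (proj₁ st)
    root    : v ∈ proj₁ st
    queued  : All (_∈ proj₁ st) (proj₂ st)
    reached : ∀ x → x ∈ proj₁ st → Walk G (_∈ proj₁ st) v x

module _ {G : Graph n} {W : List (Fin n)} {v : Fin n} {s : ℕ} where

  bfsInvariant-start : v ∉ W → BFSInvariant G W v ([ v ] , [ v ])
  bfsInvariant-start v∉W = record
    { unique  = [] ∷ []
    ; fresh   = v∉W ∷ []
    ; root    = here refl
    ; queued  = here refl ∷ []
    ; reached = λ { _ (here refl) → here (here refl) } }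

  bfsInvariant-step : ∀ {st st′} → BFSStep G W s st st′ → BFSInvariant G W v st → BFSInvariant G W v st′
  bfsInvariant-step (discover {vis} {u} {q} {w} u~w w∉W w∉vis _) I = record
    { unique  = Unique.++⁺ unique ([] ∷ []) λ { (w∈vis , here refl) → w∉vis w∈vis }
    ; fresh   = All.++⁺ fresh (w∉W ∷ [])
    ; root    = ∈-++⁺ˡ root
    ; queued  = All.++⁺ (All.map ∈-++⁺ˡ queued) (w∈ ∷ [])
    ; reached = reached′ }
    where
    open BFSInvariant I
    w∈ : w ∈ vis ++ [ w ]
    w∈ = ∈-++⁺ʳ vis (here refl)
    u∈ : u ∈ vis
    u∈ = All.head queued
    reached′ : ∀ x → x ∈ vis ++ [ w ] → Walk G (_∈ vis ++ [ w ]) v x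
    reached′ x x∈ with ∈-++⁻ vis x∈
    ... | inj₁ x∈vis       = walk-weaken ∈-++⁺ˡ (reached x x∈vis)
    ... | inj₂ (here refl) =
      walk-++ (walk-weaken ∈-++⁺ˡ (reached u u∈)) (there (∈-++⁺ˡ u∈) u~w (here w∈))
  bfsInvariant-step (dequeue _) I = record
    { unique = unique ; fresh = fresh ; root = root ; queued = All.tail queued ; reached = reached }
    where open BFSInvariant I

  bfsInvariant-run : ∀ {st st′} → Star (BFSStep G W s) st st′ → BFSInvariant G W v st → BFSInvariant G W v st′
  bfsInvariant-run ε          I = I
  bfsInvariant-run (st ◅ sts) I = bfsInvariant-run sts (bfsInvariant-step st I)

  bfsRun-isCloud : ∀ {C} → v ∉ W → BFSRun G W s v C → IsCloud G C × All (_∉ W) C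
  bfsRun-isCloud v∉W (_ , run , _) = record
    { unique    = unique
    ; nonempty  = v , root
    ; connected = λ x y x∈ y∈ → walk-++ (walk-reverse (reached x x∈)) (reached y y∈) }
    , fresh
    where open BFSInvariant (bfsInvariant-run run (bfsInvariant-start v∉W))

cloudProcess-isCloudFamily : {G : Graph n} {s : ℕ} {P : List (List (Fin n))} → CloudProcess G s P → IsCloudFamily G P
cloudProcess-isCloudFamily start = record { clouds = [] ; disjoint = [] }
cloudProcess-isCloudFamily {G = G} (step {P} {v} {C} process v∉P run) = record
  { clouds   = All.++⁺ clouds (cloud ∷ [])
  ; disjoint = AllPairs.++⁺ disjoint ([] ∷ []) (All.tabulate λ D∈P → disjoint-from D∈P ∷ []) }
  where
  open IsCloudFamily (cloudProcess-isCloudFamily process)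
  cloud : IsCloud G C
  cloud = proj₁ (bfsRun-isCloud v∉P run)
  fresh : All (_∉ concat P) C
  fresh = proj₂ (bfsRun-isCloud v∉P run)
  disjoint-from : ∀ {D} → D ∈ P → Disjoint D C
  disjoint-from D∈P (x∈D , x∈C) = All.lookup fresh x∈C (∈-concat⁺′ x∈D D∈P)

isCloudFamily-unique-concat : {G : Graph n} {P : List (List (Fin n))} → IsCloudFamily G P → Unique (concat P)
isCloudFamily-unique-concat F = Unique.concat⁺ (All.map IsCloud.unique clouds) disjoint
  where open IsCloudFamily F

lookup-++-∈ˡ : (xs ys : List A) (i : Fin (length (xs ++ ys))) → toℕ i < length xs → lookup (xs ++ ys) i ∈ xs
lookup-++-∈ˡ (_ ∷ _)  _  zero    _         = here refl
lookup-++-∈ˡ (_ ∷ xs) ys (suc i) (s<s i<n) = there (lookup-++-∈ˡ xs ys i i<n)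

AllPairs-∈ : {R : A → A → Set} → (∀ {x y} → R x y → R y x) →
  ∀ {xs} → AllPairs R xs → ∀ {x y} → x ∈ xs → y ∈ xs → x ≢ y → R x y
AllPairs-∈ R-sym (_ ∷ _)    (here refl) (here refl) x≢x = contradiction refl x≢x
AllPairs-∈ R-sym (Rx ∷ _)   (here refl) (there y∈)  _   = All.lookup Rx y∈
AllPairs-∈ R-sym (Rx ∷ _)   (there x∈)  (here refl) _   = R-sym (All.lookup Rx x∈)
AllPairs-∈ R-sym (_ ∷ Rxs)  (there x∈)  (there y∈)  x≢y = AllPairs-∈ R-sym Rxs x∈ y∈ x≢y

lookup-injective : {xs : List A} → Unique xs → ∀ i j → lookup xs i ≡ lookup xs j → i ≡ j
lookup-injective {xs = _ ∷ _} _        zero    zero    _ = refl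
lookup-injective {xs = _ ∷ _} (x∉ ∷ _) zero    (suc j) e = contradiction e (All.lookup x∉ (∈-lookup j))
lookup-injective {xs = _ ∷ _} (x∉ ∷ _) (suc i) zero    e = contradiction (sym e) (All.lookup x∉ (∈-lookup i))
lookup-injective {xs = _ ∷ _} (_ ∷ u)  (suc i) (suc j) e = cong suc (lookup-injective u i j e)

length-concat-∷ʳ : (P : List (List A)) (C : List A) → length (concat (P ++ [ C ])) ≡ length (concat P) + length C
length-concat-∷ʳ P C = begin
  length (concat (P ++ [ C ]))         ≡⟨ cong length (concat-++ P [ C ]) ⟨
  length (concat P ++ C ++ [])         ≡⟨ length-++ (concat P) ⟩
  length (concat P) + length (C ++ []) ≡⟨ cong (λ D → length (concat P) + length D) (++-identityʳ C) ⟩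
  length (concat P) + length C         ∎
  where open ≡-Reasoning

unique-length≤ : {xs : List (Fin n)} → Unique xs → length xs ≤ n
unique-length≤ {xs = xs} u = ≮⇒≥ λ n<len →
  let i , j , i<j , e = pigeonhole n<len (lookup xs) in <-irrefl (cong toℕ (lookup-injective u i j e)) i<j

-- Existence of cloud partitions

module _ (G : Graph n) (s : ℕ) where
  open DecMembership (_≟_ {n}) using (_∈?_)

  unvisitedVertex? : (W : List (Fin n)) → (∃[ x ] x ∉ W) ⊎ (∀ x → x ∈ W)
  unvisitedVertex? W with any? (λ x → ¬? (x ∈? W))
  ... | yes x∉W = inj₁ x∉W
  ... | no  ∄   = inj₂ λ x → decidable-stable (x ∈? W) λ x∉W → ∄ (x , x∉W)

  unvisitedNeighbour? : (W vis : List (Fin n)) (u : Fin n) →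
    (∃[ w ] (adj G u w ≡ true × w ∉ W × w ∉ vis)) ⊎ (∀ w → adj G u w ≡ true → w ∉ W → w ∈ vis)
  unvisitedNeighbour? W vis u with any? (λ w → (adj G u w ≟ᵇ true) ×-dec ¬? (w ∈? W) ×-dec ¬? (w ∈? vis))
  ... | yes found = inj₁ found
  ... | no  ∄     = inj₂ λ w u~w w∉W → decidable-stable (w ∈? vis) λ w∉vis → ∄ (w , u~w , w∉W , w∉vis)

  BFSCompletion : List (Fin n) → BFSState n → Set
  BFSCompletion W st = ∃[ C ] ∃[ q ] (Star (BFSStep G W s) st (C , q) × (length C ≡ s ⊎ q ≡ []))

  _◅ᶜ_ : ∀ {W st st′} → BFSStep G W s st st′ → BFSCompletion W st′ → BFSCompletion W st
  next ◅ᶜ (C , q , run , stop) = C , q , next ◅ run , stop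

  -- Discovering a vertex consumes the remaining capacity a; dequeuing shortens the queue.
  bfs-complete       : ∀ W a vis q → length vis + a ≡ s → BFSCompletion W (vis , q)
  bfs-complete-queue : ∀ W a vis q → length vis + suc a ≡ s → BFSCompletion W (vis , q)
  bfs-complete W zero    vis q full = vis , q , ε , inj₁ (trans (sym (+-identityʳ _)) full)
  bfs-complete W (suc a) vis q room = bfs-complete-queue W a vis q room
  bfs-complete-queue W a vis []      _    = vis , [] , ε , inj₂ refl
  bfs-complete-queue W a vis (u ∷ q) room with unvisitedNeighbour? W vis u
  ... | inj₁ (w , u~w , w∉W , w∉vis) =
    discover u~w w∉W w∉vis (subst (length vis <_) room (m<m+n (length vis) z<s))
      ◅ᶜ bfs-complete W a (vis ++ [ w ]) ((u ∷ q) ++ [ w ])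
           (trans (cong (_+ a) (length-++ vis)) (trans (+-assoc (length vis) 1 a) room))
  ... | inj₂ saturated = dequeue saturated ◅ᶜ bfs-complete-queue W a vis q room

  bfsRun-exists : 1 ≤ s → ∀ W v → ∃[ C ] BFSRun G W s v C
  bfsRun-exists 1≤s W v = bfs-complete W (s ∸ 1) [ v ] [ v ] (m+[n∸m]≡n 1≤s)

  cloudPartition-extend : 1 ≤ s → ∀ fuel P → CloudProcess G s P → n ≤ length (concat P) + fuel →
    ∃[ P′ ] CloudPartition G s P′
  cloudPartition-extend 1≤s fuel P process n≤ with unvisitedVertex? (concat P)
  ... | inj₂ covered = P , process , covered
  ... | inj₁ (x , x∉P) with fuel
  ...   | zero = contradiction (≤-trans visited<n (subst (n ≤_) (+-identityʳ _) n≤)) (n≮n _)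
    where
    visited<n : length (concat P) < n
    visited<n = unique-length≤ (All.¬Any⇒All¬ _ x∉P ∷ isCloudFamily-unique-concat (cloudProcess-isCloudFamily process))
  ...   | suc fuel′ with bfsRun-exists 1≤s (concat P) x
  ...     | C , run = cloudPartition-extend 1≤s fuel′ (P ++ [ C ]) (step process x∉P run) (begin
    n                                    ≤⟨ n≤ ⟩
    length (concat P) + suc fuel′        ≡⟨ +-assoc (length (concat P)) 1 fuel′ ⟨
    length (concat P) + 1 + fuel′        ≤⟨ +-monoˡ-≤ fuel′ (+-monoʳ-≤ (length (concat P)) C-nonempty) ⟩
    length (concat P) + length C + fuel′ ≡⟨ cong (_+ fuel′) (length-concat-∷ʳ P C) ⟨
    length (concat (P ++ [ C ])) + fuel′ ∎)
    where
    open ≤-Reasoning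
    C-nonempty : 1 ≤ length C
    C-nonempty = ∈-length (proj₂ (IsCloud.nonempty (proj₁ (bfsRun-isCloud x∉P run))))

  cloudPartition-exists : 1 ≤ s → ∃[ P ] CloudPartition G s P
  cloudPartition-exists 1≤s = cloudPartition-extend 1≤s n [] start ≤-refl

-- Critical clouds

isCloudFamily-filterᵇ : {G : Graph n} {P : List (List (Fin n))} (p : List (Fin n) → Bool) →
  IsCloudFamily G P → IsCloudFamily G (filterᵇ p P)
isCloudFamily-filterᵇ p F = record
  { clouds = All.filter⁺ (T? ∘ p) clouds ; disjoint = AllPairs.filter⁺ (T? ∘ p) disjoint }
  where open IsCloudFamily F

length-concat-uniform : ∀ {s} (Cs : List (List A)) → All (λ C → length C ≡ s) Cs → length (concat Cs) ≡ length Cs * s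
length-concat-uniform []       []         = refl
length-concat-uniform (C ∷ Cs) (|C| ∷ |Cs|) =
  trans (length-++ C) (cong₂ _+_ |C| (length-concat-uniform Cs |Cs|))

bigClouds*s≤n : {G : Graph n} {P : List (List (Fin n))} (s : ℕ) → IsCloudFamily G P →
  length (filterᵇ (isBig s) P) * s ≤ n
bigClouds*s≤n {P = P} s F = subst (_≤ _)
  (length-concat-uniform _ (All.map (λ {C} big → ≡ᵇ⇒≡ (length C) s big) (All.all-filter (T? ∘ isBig s) P)))
  (unique-length≤ (isCloudFamily-unique-concat (isCloudFamily-filterᵇ (isBig s) F)))

m*[1+d]≤d*[m+b]⇒m≤d*b : ∀ m d b → m * suc d ≤ d * (m + b) → m ≤ d * b
m*[1+d]≤d*[m+b]⇒m≤d*b m d b hyp = +-cancelʳ-≤ (d * m) m (d * b) (begin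
  m + d * m     ≡⟨ cong (m +_) (*-comm d m) ⟩
  m + m * d     ≡⟨ *-suc m d ⟨
  m * suc d     ≤⟨ hyp ⟩
  d * (m + b)   ≡⟨ *-distribˡ-+ d m b ⟩
  d * m + d * b ≡⟨ +-comm (d * m) (d * b) ⟩
  d * b + d * m ∎)
  where open ≤-Reasoning

module CriticalClouds {G : Graph n} (s d : ℕ) {P : List (List (Fin n))} (F : IsCloudFamily G P) where

  isCritical : List (Fin n) → Bool
  isCritical C = not (isBig s C) ∧ (suc d ≤ᵇ bigNeighbours G s P C)

  critical bigs clouds : List (List (Fin n))
  critical = filterᵇ isCritical P
  bigs     = filterᵇ (isBig s) P
  clouds   = critical ++ bigs

  k : ℕ
  k = length critical

  critical-not-big : ∀ C → T (isCritical C) → ¬ T (isBig s C)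
  critical-not-big C crit big with isBig s C
  ... | true  = crit
  ... | false = big

  ∈-critical⁻ : ∀ {C} → C ∈ critical → C ∈ P × T (isCritical C)
  ∈-critical⁻ = ∈-filter⁻ (T? ∘ isCritical) {xs = P}

  ∈-bigs⁻ : ∀ {C} → C ∈ bigs → C ∈ P × T (isBig s C)
  ∈-bigs⁻ = ∈-filter⁻ (T? ∘ isBig s) {xs = P}

  critical-bigs-disjoint : All (λ C → All (Disjoint C) bigs) critical
  critical-bigs-disjoint = All.tabulate λ {C} C∈ → All.tabulate λ D∈ →
    let C∈P , crit = ∈-critical⁻ C∈ ; D∈P , big = ∈-bigs⁻ D∈
    in AllPairs-∈ Disjoint.sym (IsCloudFamily.disjoint F) C∈P D∈P λ { refl → critical-not-big C crit big }

  clouds-isCloudFamily : IsCloudFamily G clouds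
  clouds-isCloudFamily = record
    { clouds   = All.++⁺ (IsCloudFamily.clouds critical#) (IsCloudFamily.clouds bigs#)
    ; disjoint = AllPairs.++⁺ (IsCloudFamily.disjoint critical#) (IsCloudFamily.disjoint bigs#) critical-bigs-disjoint }
    where
    critical# : IsCloudFamily G critical
    critical# = isCloudFamily-filterᵇ isCritical F
    bigs# : IsCloudFamily G bigs
    bigs# = isCloudFamily-filterᵇ (isBig s) F

  Q : Graph (length clouds)
  Q = contraction G clouds

  -- An index j beyond k differs from the critical index i, so the guard i ≢ j of Q's adjacency holds.
  adj-Q-bigs : ∀ {i} j → toℕ i < k →
    not (toℕ j <ᵇ k) ∧ adj Q i j ≡ not (toℕ j <ᵇ k) ∧ cloudsAdj G (lookup clouds i) (lookup clouds j)
  adj-Q-bigs {i} j i<k with toℕ j <ᵇ k in j<ᵇk | i ≟ j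
  ... | true  | _        = refl
  ... | false | no _     = refl
  ... | false | yes refl = contradiction (trans (sym j<ᵇk) (<⇒<ᵇ≡true i<k)) λ ()

  critical-degree : ∀ i → toℕ i < k → suc d ≤ countB (λ j → not (toℕ j <ᵇ k) ∧ adj Q i j) (allFin (length clouds))
  critical-degree i i<k = begin
    suc d                                         ≤⟨ ≤ᵇ⇒≤ _ _ (proj₂ (Equivalence.to T-∧ crit)) ⟩
    bigNeighbours G s P C                         ≡⟨ countB-∧ (isBig s) (cloudsAdj G C) P ⟩
    countB (cloudsAdj G C) bigs                   ≡⟨ countB-suffix critical bigs (cloudsAdj G C) ⟨
    countB (λ j → not (toℕ j <ᵇ k) ∧ cloudsAdj G C (lookup clouds j)) (allFin (length clouds))
                                                  ≡⟨ countB-cong (λ j → adj-Q-bigs j i<k) (allFin _) ⟨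
    countB (λ j → not (toℕ j <ᵇ k) ∧ adj Q i j) (allFin (length clouds)) ∎
    where
    open ≤-Reasoning
    C : List (Fin n)
    C = lookup clouds i
    crit : T (isCritical C)
    crit = proj₂ (∈-critical⁻ (lookup-++-∈ˡ critical bigs i i<k))

  critical*[1+d]≤edgeCount : k * suc d ≤ edgeCount Q
  critical*[1+d]≤edgeCount = k*c≤edgeCount Q (subst (k ≤_) (sym (length-++ critical)) (m≤m+n k _)) critical-degree

criticalCount≤d*bigs : {G : Graph n} {H : Graph h} {s d : ℕ} {P : List (List (Fin n))} →
  MinorFree H G → (∀ m (Q : Graph m) → MinorFree H Q → edgeCount Q ≤ d * m) → IsCloudFamily G P →
  criticalCount G s (suc d) P ≤ d * length (filterᵇ (isBig s) P)
criticalCount≤d*bigs {s = s} {d} {P} H-free sparse F = subst (_≤ _) (sym (countB≡length-filterᵇ _ P))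
  (m*[1+d]≤d*[m+b]⇒m≤d*b k d (length bigs) (begin
    k * suc d               ≤⟨ critical*[1+d]≤edgeCount ⟩
    edgeCount Q             ≤⟨ sparse _ Q (minorFree-minor (contraction-minor clouds-isCloudFamily) H-free) ⟩
    d * length clouds       ≡⟨ cong (d *_) (length-++ critical) ⟩
    d * (k + length bigs)   ∎))
  where
  open CriticalClouds s d F
  open ≤-Reasoning

n≤n^p : ∀ {n p} → 1 ≤ n → 1 ≤ p → n ≤ n ^ p
n≤n^p {n} {p} 1≤n 1≤p = subst (_≤ n ^ p) (^-identityʳ n) (^-monoʳ-≤ n {{>-nonZero 1≤n}} 1≤p)

n≤2^t⇒⌊log₂n⌋≤t : ∀ {n t} → n ≤ 2 ^ t → ⌊log₂ n ⌋ ≤ t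
n≤2^t⇒⌊log₂n⌋≤t {t = t} n≤2^t = subst (_ ≤_) (⌊log₂[2^n]⌋≡n t) (⌊log₂⌋-mono-≤ n≤2^t)

cloudSize-positive : ∀ {n s q} → 2 ≤ n → n ≤ 2 ^ (s * q) → 1 ≤ s
cloudSize-positive {s = zero}  2≤n n≤1 = contradiction (≤-trans 2≤n n≤1) λ { (s≤s ()) }
cloudSize-positive {s = suc _} _   _   = s≤s z≤n

lemma18 : (p q : ℕ) → 0 < p → 0 < q →
          (h : ℕ) (H : Graph h) (d : ℕ) →
          (∀ m (G : Graph m) → MinorFree H G → edgeCount G ≤ d * m) →
          (∀ d′ → d′ < d → ∃[ m ] ∃[ G ] (MinorFree {h} {m} H G × d′ * m < edgeCount G)) →
          ∃[ K ] (∀ n → 2 ≤ n → (G : Graph n) → Connected G → MinorFree H G →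
            (s : ℕ) → IsCeilCLog p q n s →
            ∃[ P ] (CloudPartition G s P × criticalCount G s (suc d) P * ⌊log₂ n ⌋ ≤ K * n))
lemma18 p q 0<p _ h H d sparse _ = d * q , bound
  where
  bound : ∀ n → 2 ≤ n → (G : Graph n) → Connected G → MinorFree H G → (s : ℕ) → IsCeilCLog p q n s →
    ∃[ P ] (CloudPartition G s P × criticalCount G s (suc d) P * ⌊log₂ n ⌋ ≤ d * q * n)
  bound n 2≤n G _ H-free s (n^p≤2^sq , _) = P , partition , (begin
    criticalCount G s (suc d) P * ⌊log₂ n ⌋ ≤⟨ *-mono-≤ (criticalCount≤d*bigs H-free sparse F) (n≤2^t⇒⌊log₂n⌋≤t n≤2^sq) ⟩
    d * B * (s * q)                         ≡⟨ solve 4 (λ d B s q → d :* B :* (s :* q) := d :* q :* (B :* s)) refl d B s q ⟩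
    d * q * (B * s)                         ≤⟨ *-monoʳ-≤ (d * q) (bigClouds*s≤n s F) ⟩
    d * q * n                               ∎)
    where
    open ≤-Reasoning
    open +-*-Solver
    n≤2^sq : n ≤ 2 ^ (s * q)
    n≤2^sq = ≤-trans (n≤n^p (≤-trans (s≤s z≤n) 2≤n) 0<p) n^p≤2^sq
    P : List (List (Fin n))
    P = proj₁ (cloudPartition-exists G s (cloudSize-positive 2≤n n≤2^sq))
    partition : CloudPartition G s P
    partition = proj₂ (cloudPartition-exists G s (cloudSize-positive 2≤n n≤2^sq))
    F : IsCloudFamily G P
    F = cloudProcess-isCloudFamily (proj₁ partition)
    B : ℕ
    B = length (filterᵇ (isBig s) P)
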